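{- For every integer $t \ge 3$ there exists a sequence of sets $(I_n)_{n \ge 3}$ such that each $I_n \subset [t]^n$ is an independent set of $K_t^n$, $\epsilon_n := 1 - t\mu(I_n) > 0$ for all $n$, $\epsilon_n \to 0$ as $n \to \infty$, and for every $n$ and every maximum-sized independent set $J_n$ of $K_t^n$, \[ \mu(I_n \setminus J_n) > \frac{t-1}{t}\,\epsilon_n^{\eta(t)}, \qquad \eta(t) := \frac{\log t}{\log t - \log(t-1)}. \]
   Context: $K_t^n$ is the graph with vertex set $[t]^n = \{1,\dots,t\}^n$ in which $x,y$ are adjacent iff $x_i \neq y_i$ for all $i \in [n]$. For $S \subseteq [t]^n$, $\mu(S) := |S|/t^n$. $\log$ is the natural logarithm. -}

module Defs where

open import Data.Nat using (ℕ; zero; suc; _+_; _*_; _∸_; _^_; _≤_; _<_)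
open import Data.Fin using (Fin; zero; suc)
open import Data.Bool using (Bool; true; false; _∧_; not)
open import Data.List using (List; []; _∷_; map; concatMap; filter; length)
open import Data.Product using (Σ; ∃; _×_; _,_)
open import Relation.Binary.PropositionalEquality using (_≡_; _≢_)
open import Relation.Nullary using (¬_)
open import Relation.Nullary.Decidable using (Dec)
open import Data.Bool.Properties using (T?)
open import Data.Bool using (T)

Vertex : ℕ → ℕ → Set
Vertex t n = Fin n → Fin t

Adjacent : ∀ {t n} → Vertex t n → Vertex t n → Set
Adjacent {n = n} x y = (i : Fin n) → x i ≢ y i

VSet : ℕ → ℕ → Set
VSet t n = Vertex t n → Bool

Independent : ∀ {t n} → VSet t n → Set
Independent {t} {n} S =
  (x y : Vertex t n) → S x ≡ true → S y ≡ true → ¬ Adjacent x y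

cons : ∀ {t n} → Fin t → Vertex t n → Vertex t (suc n)
cons a x zero    = a
cons a x (suc i) = x i

allFin : (t : ℕ) → List (Fin t)
allFin zero    = []
allFin (suc t) = zero ∷ map suc (allFin t)

vertices : (t n : ℕ) → List (Vertex t n)
vertices t zero    = (λ ()) ∷ []
vertices t (suc n) = concatMap (λ a → map (cons a) (vertices t n)) (allFin t)

card : ∀ {t n} → VSet t n → ℕ
card {t} {n} S = length (filter (λ x → T? (S x)) (vertices t n))

_∖_ : ∀ {t n} → VSet t n → VSet t n → VSet t n
(S ∖ R) x = S x ∧ not (R x)

MaximumIndependent : ∀ {t n} → VSet t n → Set
MaximumIndependent {t} {n} J =
  Independent J × ((K : VSet t n) → Independent K → card K ≤ card J)

-- Measures, with denominators cleared (N = t^n):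
--   μ(S) = card S / N,   ε(I) = 1 - t μ(I) = (N ∸ t·card I) / N  (when t·card I ≤ N).
-- "ε(I) > 0" ⟺ t · card I < N.
EpsPos : ∀ {t n} → VSet t n → Set
EpsPos {t} {n} I = t * card I < t ^ n

-- "ε(I) < 1/k"  ⟺  k · (N - t·card I) < N   (given ε(I) > 0).
EpsBelow : ∀ {t n} → VSet t n → ℕ → Set
EpsBelow {t} {n} I k = k * (t ^ n ∸ t * card I) < t ^ n

-- η(t) = log t / (log t - log(t-1)) = log t / log (t/(t-1)).
-- For naturals r and s > 0:  r/s < η(t)  ⟺  (t/(t-1))^r < t^s  ⟺  t^r < t^s (t-1)^r.
RatBelowEta : ℕ → ℕ → ℕ → Set
RatBelowEta t r s = t ^ r < t ^ s * (t ∸ 1) ^ r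

-- Exact rational encoding of the real inequality
--     μ(I ∖ J) > ((t-1)/t) · ε^η(t),   ε = ε(I) ∈ (0,1],
-- namely: there are naturals r, s with s > 0, r/s < η(t) and
--     (μ(I∖J) · t/(t-1))^s > ε^r.
-- (Since y ↦ ε^y is continuous and nonincreasing on [0,∞) and η(t) > 0, for
-- x ≥ 0 we have x > ε^η ⟺ ∃ rational 0 ≤ r/s < η with x^s > ε^r.)
-- With N = t^n, d = card (I∖J), i = card I, the inequality
-- (d t / (N (t-1)))^s > ((N - t i)/N)^r is cleared of denominators to
--     (d t)^s · N^r > (N - t i)^r · (N (t-1))^s.
MuDiffExceeds : ∀ {t n} → VSet t n → VSet t n → Set
MuDiffExceeds {t} {n} I J =
  Σ ℕ λ r → Σ ℕ λ s → 0 < s × RatBelowEta t r s ×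
    ((t ^ n ∸ t * card I) ^ r * (t ^ n * (t ∸ 1)) ^ s
       < (card (I ∖ J) * t) ^ s * (t ^ n) ^ r)

module Submission where

-- Write a = t - 1.  I (m + 1) consists of the words x with x₀ = 0 and some later
-- letter 0, together with the a words (c, 0, …, 0) with c ≠ 0.  It is independent,
-- and |I (m + 1)| = t^m - a^m + a, so ε = t a X / t^(m+1) with X = a^(m-1) - 1.
--
-- For t ≥ 3 every maximum independent set J is, on the listed words, a dictatorship
-- {x | x_i = b}.  A Latin-square double count shows that an independent set missing
-- one of the cliques {(π_i(j))_i | j < t} has fewer than t^(n-1) elements, so J meets
-- every such clique.  Fixing the tail of a clique and varying the first letter gives
-- a t × t Boolean matrix whose true entries pairwise share a row or a column and which
-- meets every permutation, hence is a full row or a full column.  This propagates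
-- along edges, so J either ignores its first letter (and we recurse on the tail) or
-- is the dictatorship of the first letter.
--
-- A dictatorship misses one of the axes {x | x_j ≠ 0, x_i = 0 for i ≠ j} ⊆ I n, so
-- |I n ∖ J| ≥ a.  For r = t^m X Bernoulli's inequality gives t^m X^r < (X + 1)^r, and
-- with s + 1 the least exponent such that t^r < t^(s+1) a^r, i.e. r/(s+1) < η(t), this
-- yields (μ(I n ∖ J) t/a)^(s+1) > ε^r.

open import Defs

open import Data.Bool using (Bool; true; false; _∧_; _∨_; not; if_then_else_)
open import Data.Bool.Properties using (T?; ¬-not; ∧-conicalˡ; ∧-conicalʳ; ∨-zeroʳ)
import Data.Bool.Properties as Bool using (_≟_)
open import Data.Empty using (⊥; ⊥-elim)
open import Data.Fin using (Fin; zero; suc; toℕ; punchIn; punchOut)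
open import Data.Fin.Patterns using (0F; 1F; 2F)
open import Data.Fin.Permutation as Perm using (Permutation; Permutation′; _⟨$⟩ʳ_; _⟨$⟩ˡ_; _∘ₚ_)
open import Data.Fin.Properties
  using (_≟_; toℕ-injective; toℕ<n; toℕ-fromℕ<; punchInᵢ≢i; punchIn-punchOut; all?; any?; ¬∀⟶∃¬)
import Data.Fin.Properties as Fin using (suc-injective)
open import Data.List using (List; []; _∷_; map; concatMap; filter; length; _++_)
import Data.List.Properties as List using (map-∘; map-cong; map-++)
open import Data.Nat
  using (ℕ; zero; suc; pred; _+_; _*_; _∸_; _^_; _≤_; _<_; z≤n; s≤s; z<s; NonZero)
open import Data.Nat.DivMod using (_%_; _mod_; m%n<n; m%n%n≡m%n; [m+n]%n≡m%n; m<n⇒m%n≡m; %-distribˡ-+)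
import Data.Nat.ListAction as List using (sum)
import Data.Nat.ListAction.Properties as List using (sum-++)
open import Data.Nat.Properties hiding (_≟_)
open import Data.Nat.Tactic.RingSolver using (solve-∀)
open import Algebra.Properties.Semiring.Sum +-*-semiring
  using (sum; sum-syntax; sum-cong-≗; sum-replicate-zero; ∑-comm; ∑-distrib-+; sum-permute)
open import Data.Product using (Σ; ∃; _×_; _,_; proj₁; proj₂)
open import Data.Sum using (_⊎_; inj₁; inj₂)
open import Data.Vec.Functional using (tail)
import Data.Vec.Functional as Vector using (_∷_)
open import Function using (_∘_)
open import Function.Bundles using (Injection)
open import Function.Definitions using (Congruent)
open import Function.Properties.Inverse using (↔⇒↣)
open import Relation.Binary.PropositionalEquality
open import Relation.Nullary using (¬_; Dec; yes; no; does)
open import Relation.Nullary.Decidable using (dec-true; dec-false)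
open import Relation.Unary using (Decidable)

𝟙 : Bool → ℕ
𝟙 true  = 1
𝟙 false = 0

𝟙-mono : ∀ {b c} → (b ≡ true → c ≡ true) → 𝟙 b ≤ 𝟙 c
𝟙-mono {false} b⇒c = z≤n
𝟙-mono {true}  b⇒c rewrite b⇒c refl = ≤-refl

𝟙-complement : ∀ b → 𝟙 b + 𝟙 (not b) ≡ 1
𝟙-complement true  = refl
𝟙-complement false = refl

does-true : ∀ {p} {P : Set p} (P? : Dec P) → does P? ≡ true → P
does-true (yes p) _ = p

∑-mono-≤ : ∀ {k} {f g : Fin k → ℕ} → (∀ i → f i ≤ g i) → sum f ≤ sum g
∑-mono-≤ {zero}  f≤g = z≤n
∑-mono-≤ {suc k} f≤g = +-mono-≤ (f≤g 0F) (∑-mono-≤ (f≤g ∘ suc))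

∑-const : ∀ k c → ∑[ i < k ] c ≡ k * c
∑-const zero    c = refl
∑-const (suc k) c = cong (c +_) (∑-const k c)

∑-𝟙-≤1 : ∀ {k} (g : Fin k → Bool) → (∀ {i j} → g i ≡ true → g j ≡ true → i ≡ j) →
         ∑[ i < k ] 𝟙 (g i) ≤ 1
∑-𝟙-≤1 {zero}  g unique = z≤n
∑-𝟙-≤1 {suc k} g unique with g 0F in g₀
... | false = ∑-𝟙-≤1 (g ∘ suc) λ gi gj → Fin.suc-injective (unique gi gj)
... | true  = s≤s (≤-reflexive (trans (sum-cong-≗ rest-false) (sum-replicate-zero k)))
  where
  rest-false : ∀ i → 𝟙 (g (suc i)) ≡ 0
  rest-false i with g (suc i) in gᵢ
  ... | false = refl
  ... | true with () ← unique g₀ gᵢ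

-- Sums over words

-- A set of words need not respect pointwise equality of words, so sums are taken
-- over literally the words listed by `vertices`: the empty word is read off from
-- there, and `canon x` is the listed word with the same letters as x.
vertex₀ : ∀ {t} → Vertex t 0
vertex₀ {t} with vertices t 0
... | x ∷ _ = x
... | []    = λ ()

∑ᵥ : ∀ {t} n → (Vertex t n → ℕ) → ℕ
∑ᵥ zero        f = f vertex₀
∑ᵥ {t} (suc n) f = ∑[ c < t ] ∑ᵥ n (f ∘ cons c)

canon : ∀ {t n} → Vertex t n → Vertex t n
canon {n = zero}  x = vertex₀
canon {n = suc n} x = cons (x 0F) (canon (tail x))

canon-≗ : ∀ {t n} (x : Vertex t n) → canon x ≗ x
canon-≗ x zero    = refl
canon-≗ x (suc i) = canon-≗ (tail x) i

canon-cong : ∀ {t n} {x y : Vertex t n} → x ≗ y → canon x ≡ canon y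
canon-cong {n = zero}  x≗y = refl
canon-cong {n = suc n} x≗y = cong₂ cons (x≗y 0F) (canon-cong (x≗y ∘ suc))

module _ {t : ℕ} where

  ∑ᵥ-cong : ∀ n {f g : Vertex t n → ℕ} → f ≗ g → ∑ᵥ n f ≡ ∑ᵥ n g
  ∑ᵥ-cong zero    f≗g = f≗g vertex₀
  ∑ᵥ-cong (suc n) f≗g = sum-cong-≗ λ c → ∑ᵥ-cong n (f≗g ∘ cons c)

  ∑ᵥ-mono-≤ : ∀ n {f g : Vertex t n → ℕ} → (∀ x → f x ≤ g x) → ∑ᵥ n f ≤ ∑ᵥ n g
  ∑ᵥ-mono-≤ zero    f≤g = f≤g vertex₀
  ∑ᵥ-mono-≤ (suc n) f≤g = ∑-mono-≤ λ c → ∑ᵥ-mono-≤ n (f≤g ∘ cons c)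

  ∑ᵥ-const : ∀ n c → ∑ᵥ {t} n (λ _ → c) ≡ t ^ n * c
  ∑ᵥ-const zero    c = sym (+-identityʳ c)
  ∑ᵥ-const (suc n) c = begin
    ∑[ _ < t ] ∑ᵥ {t} n (λ _ → c) ≡⟨ cong (λ z → ∑[ _ < t ] z) (∑ᵥ-const n c) ⟩
    ∑[ _ < t ] (t ^ n * c)    ≡⟨ ∑-const t (t ^ n * c) ⟩
    t * (t ^ n * c)           ≡⟨ *-assoc t (t ^ n) c ⟨
    t ^ suc n * c             ∎
    where open ≡-Reasoning

  ∑ᵥ-zero : ∀ n → ∑ᵥ {t} n (λ _ → 0) ≡ 0
  ∑ᵥ-zero n = trans (∑ᵥ-const n 0) (*-zeroʳ (t ^ n))

  ∑ᵥ-distrib-+ : ∀ n (f g : Vertex t n → ℕ) → ∑ᵥ n (λ x → f x + g x) ≡ ∑ᵥ n f + ∑ᵥ n g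
  ∑ᵥ-distrib-+ zero    f g = refl
  ∑ᵥ-distrib-+ (suc n) f g = trans (sum-cong-≗ λ c → ∑ᵥ-distrib-+ n (f ∘ cons c) (g ∘ cons c))
                                   (∑-distrib-+ (λ c → ∑ᵥ n (f ∘ cons c)) (λ c → ∑ᵥ n (g ∘ cons c)))

  ∑-∑ᵥ-comm : ∀ {k} n (f : Fin k → Vertex t n → ℕ) →
              ∑[ j < k ] ∑ᵥ n (f j) ≡ ∑ᵥ n (λ x → ∑[ j < k ] f j x)
  ∑-∑ᵥ-comm zero    f = refl
  ∑-∑ᵥ-comm (suc n) f = trans (∑-comm λ j c → ∑ᵥ n (f j ∘ cons c))
                              (sum-cong-≗ λ c → ∑-∑ᵥ-comm n λ j → f j ∘ cons c)

  ∑ᵥ-canon : ∀ n (f : Vertex t n → ℕ) → ∑ᵥ n (f ∘ canon) ≡ ∑ᵥ n f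
  ∑ᵥ-canon zero    f = refl
  ∑ᵥ-canon (suc n) f = sum-cong-≗ λ c → ∑ᵥ-canon n (f ∘ cons c)

  ∑ᵥ-mono-< : ∀ n {f g : Vertex t n → ℕ} → (∀ x → f x ≤ g x) →
              (x : Vertex t n) → f (canon x) < g (canon x) → ∑ᵥ n f < ∑ᵥ n g
  ∑ᵥ-mono-< zero    f≤g x fx<gx = fx<gx
  ∑ᵥ-mono-< (suc n) f≤g x fx<gx = ∑-mono-< (λ c → ∑ᵥ-mono-≤ n (f≤g ∘ cons c)) (x 0F)
                                           (∑ᵥ-mono-< n (f≤g ∘ cons (x 0F)) (tail x) fx<gx)
    where
    ∑-mono-< : ∀ {k} {f g : Fin k → ℕ} → (∀ i → f i ≤ g i) → ∀ i → f i < g i → sum f < sum g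
    ∑-mono-< {suc k} f≤g zero    fi<gi = +-mono-<-≤ fi<gi (∑-mono-≤ (f≤g ∘ suc))
    ∑-mono-< {suc k} f≤g (suc i) fi<gi = +-mono-≤-< (f≤g 0F) (∑-mono-< (f≤g ∘ suc) i fi<gi)

  ∑ᵥ-vertices : ∀ n (f : Vertex t n → ℕ) → List.sum (map f (vertices t n)) ≡ ∑ᵥ n f
  ∑ᵥ-vertices zero    f = +-identityʳ (f vertex₀)
  ∑ᵥ-vertices (suc n) f = begin
    List.sum (map f (concatMap (λ c → map (cons c) (vertices t n)) (allFin t)))
      ≡⟨ sum-map-concatMap (allFin t) ⟩
    List.sum (map (λ c → List.sum (map f (map (cons c) (vertices t n)))) (allFin t))
      ≡⟨ cong List.sum (List.map-cong (λ c → sym (cong List.sum (List.map-∘ (vertices t n)))) (allFin t)) ⟩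
    List.sum (map (λ c → List.sum (map (f ∘ cons c) (vertices t n))) (allFin t))
      ≡⟨ cong List.sum (List.map-cong (λ c → ∑ᵥ-vertices n (f ∘ cons c)) (allFin t)) ⟩
    List.sum (map (λ c → ∑ᵥ n (f ∘ cons c)) (allFin t))
      ≡⟨ sum-allFin t _ ⟩
    ∑ᵥ (suc n) f ∎
    where
    open ≡-Reasoning
    sum-map-concatMap : ∀ {A B : Set} {f : B → ℕ} {g : A → List B} xs →
      List.sum (map f (concatMap g xs)) ≡ List.sum (map (λ a → List.sum (map f (g a))) xs)
    sum-map-concatMap         []       = refl
    sum-map-concatMap {f = f} {g} (x ∷ xs) = begin
      List.sum (map f (g x ++ concatMap g xs))            ≡⟨ cong List.sum (List.map-++ f (g x) _) ⟩
      List.sum (map f (g x) ++ map f (concatMap g xs))    ≡⟨ List.sum-++ (map f (g x)) _ ⟩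
      List.sum (map f (g x)) + List.sum (map f (concatMap g xs))
        ≡⟨ cong (List.sum (map f (g x)) +_) (sum-map-concatMap xs) ⟩
      List.sum (map f (g x)) + List.sum (map (λ a → List.sum (map f (g a))) xs) ∎
    sum-allFin : ∀ k (h : Fin k → ℕ) → List.sum (map h (allFin k)) ≡ sum h
    sum-allFin zero    h = refl
    sum-allFin (suc k) h = cong (h 0F +_) (trans (sym (cong List.sum (List.map-∘ (allFin k))))
                                                 (sum-allFin k (h ∘ suc)))

card-∑ᵥ : ∀ {t n} (S : VSet t n) → card S ≡ ∑ᵥ n (𝟙 ∘ S)
card-∑ᵥ {t} {n} S = trans (length-filter (vertices t n)) (∑ᵥ-vertices n (𝟙 ∘ S))
  where
  length-filter : ∀ xs → length (filter (λ x → T? (S x)) xs) ≡ List.sum (map (𝟙 ∘ S) xs)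
  length-filter []       = refl
  length-filter (x ∷ xs) with S x
  ... | true  = cong suc (length-filter xs)
  ... | false = length-filter xs

-- Cliques and the Latin-square count

permute : ∀ {t n} → (Fin n → Permutation′ t) → Vertex t n → Vertex t n
permute ρ x i = ρ i ⟨$⟩ʳ x i

∑ᵥ-permute : ∀ {t} n (ρ : Fin n → Permutation′ t) (f : Vertex t n → ℕ) →
             ∑ᵥ n (f ∘ canon ∘ permute ρ) ≡ ∑ᵥ n f
∑ᵥ-permute zero    ρ f = refl
∑ᵥ-permute (suc n) ρ f = trans (sum-cong-≗ λ c → ∑ᵥ-permute n (tail ρ) (f ∘ cons (ρ 0F ⟨$⟩ʳ c)))
                               (sym (sum-permute (λ c → ∑ᵥ n (f ∘ cons c)) (ρ 0F)))

⟨$⟩ʳ-injective : ∀ {t} (σ : Permutation′ t) {x y} → σ ⟨$⟩ʳ x ≡ σ ⟨$⟩ʳ y → x ≡ y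
⟨$⟩ʳ-injective σ = Injection.injective (↔⇒↣ σ)

two-point-permutation : ∀ {t} {j j' b b' : Fin t} → ¬ j ≡ j' → ¬ b ≡ b' →
                        Σ (Permutation′ t) λ σ → σ ⟨$⟩ʳ j ≡ b × σ ⟨$⟩ʳ j' ≡ b'
two-point-permutation {suc zero} {zero} {zero} j≢j' _ = ⊥-elim (j≢j' refl)
two-point-permutation {suc (suc t)} {j} {j'} {b} {b'} j≢j' b≢b' = σ , insert-self j b inner , σj'≡b'
  where
  insert-self : ∀ {m n} i j (π : Permutation m n) → Perm.insert i j π ⟨$⟩ʳ i ≡ j
  insert-self i j π with i ≟ i
  ... | yes _   = refl
  ... | no i≢i = ⊥-elim (i≢i refl)

  inner : Permutation′ (suc t)
  inner = Perm.insert (punchOut j≢j') (punchOut b≢b') Perm.id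

  σ : Permutation′ (suc (suc t))
  σ = Perm.insert j b inner

  σj'≡b' : σ ⟨$⟩ʳ j' ≡ b'
  σj'≡b' = begin
    σ ⟨$⟩ʳ j'                              ≡⟨ cong (σ ⟨$⟩ʳ_) (punchIn-punchOut j≢j') ⟨
    σ ⟨$⟩ʳ punchIn j (punchOut j≢j')       ≡⟨ Perm.insert-punchIn j b inner (punchOut j≢j') ⟩
    punchIn b (inner ⟨$⟩ʳ punchOut j≢j')   ≡⟨ cong (punchIn b) (insert-self (punchOut j≢j') (punchOut b≢b') Perm.id) ⟩
    punchIn b (punchOut b≢b')              ≡⟨ punchIn-punchOut b≢b' ⟩
    b'                                     ∎
    where open ≡-Reasoning

clique : ∀ {t n} → (Fin n → Permutation′ t) → Fin t → Vertex t n
clique π j i = π i ⟨$⟩ʳ j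

clique-adjacent : ∀ {t n} (π : Fin n → Permutation′ t) {j j'} → ¬ j ≡ j' →
                  Adjacent (clique π j) (clique π j')
clique-adjacent π j≢j' i eq = j≢j' (⟨$⟩ʳ-injective (π i) eq)

independent-∑-clique-≤1 : ∀ {t n} {J : VSet t n} → Independent J → (v : Fin t → Vertex t n) →
  (∀ {j j'} → ¬ j ≡ j' → Adjacent (v j) (v j')) → ∑[ j < t ] 𝟙 (J (v j)) ≤ 1
independent-∑-clique-≤1 {J = J} indep v adjacent = ∑-𝟙-≤1 (J ∘ v) unique
  where
  unique : ∀ {j j'} → J (v j) ≡ true → J (v j') ≡ true → j ≡ j'
  unique {j} {j'} Jvj Jvj' with j ≟ j'
  ... | yes j≡j' = j≡j'
  ... | no  j≢j' = ⊥-elim (indep (v j) (v j') Jvj Jvj' (adjacent j≢j'))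

module _ {k : ℕ} where
  private
    t : ℕ
    t = suc k

  infixl 6 _⊕_ _⊖_

  _⊕_ _⊖_ : Fin t → Fin t → Fin t
  y ⊕ j = (toℕ y + toℕ j) mod t
  z ⊖ j = (toℕ z + (t ∸ toℕ j)) mod t

  private
    toℕ-mod : ∀ m → toℕ (m mod t) ≡ m % t
    toℕ-mod m = toℕ-fromℕ< (m%n<n m t)

    mod-cancel : ∀ a b c → b + c ≡ t → a < t → ((a + b) % t + c) % t ≡ a
    mod-cancel a b c b+c≡t a<t = begin
      ((a + b) % t + c) % t           ≡⟨ %-distribˡ-+ ((a + b) % t) c t ⟩
      ((a + b) % t % t + c % t) % t   ≡⟨ cong (λ u → (u + c % t) % t) (m%n%n≡m%n (a + b) t) ⟩
      ((a + b) % t + c % t) % t       ≡⟨ %-distribˡ-+ (a + b) c t ⟨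
      (a + b + c) % t                 ≡⟨ cong (_% t) (trans (+-assoc a b c) (cong (a +_) b+c≡t)) ⟩
      (a + t) % t                     ≡⟨ [m+n]%n≡m%n a t ⟩
      a % t                           ≡⟨ m<n⇒m%n≡m a<t ⟩
      a                               ∎
      where open ≡-Reasoning

  ⊕-comm : ∀ y j → y ⊕ j ≡ j ⊕ y
  ⊕-comm y j = cong (_mod t) (+-comm (toℕ y) (toℕ j))

  ⊕-⊖ˡ : ∀ y j → (y ⊕ j) ⊖ y ≡ j
  ⊕-⊖ˡ y j = toℕ-injective (begin
    toℕ ((y ⊕ j) ⊖ y)                         ≡⟨ toℕ-mod (toℕ (y ⊕ j) + (t ∸ toℕ y)) ⟩
    (toℕ (y ⊕ j) + (t ∸ toℕ y)) % t           ≡⟨ cong (λ u → (u + (t ∸ toℕ y)) % t) (toℕ-mod (toℕ y + toℕ j)) ⟩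
    ((toℕ y + toℕ j) % t + (t ∸ toℕ y)) % t   ≡⟨ cong (λ u → (u % t + (t ∸ toℕ y)) % t) (+-comm (toℕ y) (toℕ j)) ⟩
    ((toℕ j + toℕ y) % t + (t ∸ toℕ y)) % t   ≡⟨ mod-cancel (toℕ j) (toℕ y) _ (m+[n∸m]≡n (<⇒≤ (toℕ<n y))) (toℕ<n j) ⟩
    toℕ j                                     ∎)
    where open ≡-Reasoning

  ⊖-⊕ : ∀ z j → (z ⊖ j) ⊕ j ≡ z
  ⊖-⊕ z j = toℕ-injective (begin
    toℕ ((z ⊖ j) ⊕ j)                         ≡⟨ toℕ-mod (toℕ (z ⊖ j) + toℕ j) ⟩
    (toℕ (z ⊖ j) + toℕ j) % t                 ≡⟨ cong (λ u → (u + toℕ j) % t) (toℕ-mod (toℕ z + (t ∸ toℕ j))) ⟩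
    ((toℕ z + (t ∸ toℕ j)) % t + toℕ j) % t   ≡⟨ mod-cancel (toℕ z) (t ∸ toℕ j) _ (m∸n+n≡m (<⇒≤ (toℕ<n j))) (toℕ<n z) ⟩
    toℕ z                                     ∎)
    where open ≡-Reasoning

  ⊕-cancelˡ : ∀ y {j j'} → y ⊕ j ≡ y ⊕ j' → j ≡ j'
  ⊕-cancelˡ y {j} {j'} eq = trans (sym (⊕-⊖ˡ y j)) (trans (cong (_⊖ y) eq) (⊕-⊖ˡ y j'))

  shift : Fin t → Permutation′ t
  shift j = Perm.permutation (_⊕ j) (_⊖ j) (λ z → ⊖-⊕ z j)
                             (λ y → trans (cong (_⊖ j) (⊕-comm y j)) (⊕-⊖ˡ j y))

  card-<-of-missed-clique : ∀ {n} {J : VSet t n} → Independent J → (π : Fin n → Permutation′ t) →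
                            (∀ j → J (canon (clique π j)) ≡ false) → t * card J < t ^ n
  card-<-of-missed-clique {n} {J} indep π missed = begin-strict
    t * card J                                    ≡⟨ ∑-const t (card J) ⟨
    ∑[ j < t ] card J                             ≡⟨ sum-cong-≗ (λ j → trans (card-∑ᵥ J) (sym (∑ᵥ-permute n (ρ j) (𝟙 ∘ J)))) ⟩
    ∑[ j < t ] ∑ᵥ n (λ x → 𝟙 (J (canon (τ j x)))) ≡⟨ ∑-∑ᵥ-comm n (λ j x → 𝟙 (J (canon (τ j x)))) ⟩
    ∑ᵥ n hits                                     <⟨ ∑ᵥ-mono-< n hits≤1 (clique π 0F) no-hit-at-clique ⟩
    ∑ᵥ n (λ _ → 1)                                ≡⟨ ∑ᵥ-const n 1 ⟩
    t ^ n * 1                                     ≡⟨ *-identityʳ (t ^ n) ⟩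
    t ^ n                                         ∎
    where
    open ≤-Reasoning
    -- τ j shifts every letter by j in the frame of π: for each x the τ j x are pairwise
    -- adjacent, and τ j moves clique π 0F to clique π (0F ⊕ j).
    ρ : Fin t → Fin n → Permutation′ t
    ρ j i = Perm.flip (π i) ∘ₚ shift j ∘ₚ π i

    τ : Fin t → Vertex t n → Vertex t n
    τ j = permute (ρ j)

    hits : Vertex t n → ℕ
    hits x = ∑[ j < t ] 𝟙 (J (canon (τ j x)))

    hits≤1 : ∀ x → hits x ≤ 1
    hits≤1 x = independent-∑-clique-≤1 indep (λ j → canon (τ j x)) λ {j} {j'} j≢j' i eq →
      j≢j' (⊕-cancelˡ (π i ⟨$⟩ˡ x i)
        (⟨$⟩ʳ-injective (π i) (trans (sym (canon-≗ (τ j x) i)) (trans eq (canon-≗ (τ j' x) i)))))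

    τ-clique : ∀ j i → τ j (canon (clique π 0F)) i ≡ clique π (0F ⊕ j) i
    τ-clique j i = cong (λ y → π i ⟨$⟩ʳ (y ⊕ j))
                        (trans (cong (π i ⟨$⟩ˡ_) (canon-≗ (clique π 0F) i)) (Perm.inverseˡ (π i)))

    no-hit-at-clique : hits (canon (clique π 0F)) < 1
    no-hit-at-clique = s≤s (≤-reflexive (trans (sum-cong-≗ missed-after-τ) (sum-replicate-zero t)))
      where
      missed-after-τ : ∀ j → 𝟙 (J (canon (τ j (canon (clique π 0F))))) ≡ 0
      missed-after-τ j = cong 𝟙 (trans (cong J (canon-cong (τ-clique j))) (missed (0F ⊕ j)))

-- Independent sets meeting every clique are dictatorships

module _ {k} (R : Fin (2 + k) → Fin (2 + k) → Bool)
  (aligned : ∀ {j j' c c'} → R j c ≡ true → R j' c' ≡ true → ¬ j ≡ j' → ¬ c ≡ c' → ⊥)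
  (meets : ∀ (σ : Permutation′ (2 + k)) → ∃ λ j → R j (σ ⟨$⟩ʳ j) ≡ true) where

  full-row-or-column : (∃ λ j → ∀ c → R j c ≡ true) ⊎ (∃ λ c → ∀ j → R j c ≡ true)
  full-row-or-column with meets Perm.id
  ... | j , Rjj with all? (λ c → R j c Bool.≟ true) | all? (λ l → R l j Bool.≟ true)
  ...   | yes row | _          = inj₁ (j , row)
  ...   | no _    | yes column = inj₂ (j , column)
  ...   | no ¬row | no ¬column
    with b , ¬Rjb ← ¬∀⟶∃¬ _ _ (λ c → R j c Bool.≟ true) ¬row
       | j' , ¬Rj'j ← ¬∀⟶∃¬ _ _ (λ l → R l j Bool.≟ true) ¬column
    -- A permutation through (j, b) and (j', j) must meet R off row j and off column j.
    with σ , σj≡b , σj'≡j ← two-point-permutation {j = j} {j'} {b} {j} (λ { refl → ¬Rj'j Rjj }) (λ { refl → ¬Rjb Rjj })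
    with l , Rlσl ← meets σ
    = ⊥-elim (aligned Rjj Rlσl (l≢j ∘ sym) (σl≢j ∘ sym))
    where
    l≢j : ¬ l ≡ j
    l≢j refl = ¬Rjb (subst (λ c → R j c ≡ true) σj≡b Rlσl)
    l≢j' : ¬ l ≡ j'
    l≢j' refl = ¬Rj'j (subst (λ c → R j' c ≡ true) σj'≡j Rlσl)
    σl≢j : ¬ σ ⟨$⟩ʳ l ≡ j
    σl≢j eq = l≢j' (⟨$⟩ʳ-injective σ (trans eq (sym σj'≡j)))

  row-or-column-indicator : (∃ λ j → ∀ l c → R l c ≡ does (l ≟ j)) ⊎ (∃ λ a → ∀ l c → R l c ≡ does (c ≟ a))
  row-or-column-indicator with full-row-or-column
  ... | inj₁ (j , row)    = inj₁ (j , only-row)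
    where
    only-row : ∀ l c → R l c ≡ does (l ≟ j)
    only-row l c with l ≟ j
    ... | yes refl = row c
    ... | no  l≢j  = ¬-not λ Rlc → aligned Rlc (row (punchIn c 0F)) l≢j (punchInᵢ≢i c 0F ∘ sym)
  ... | inj₂ (a , column) = inj₂ (a , only-column)
    where
    only-column : ∀ l c → R l c ≡ does (c ≟ a)
    only-column l c with c ≟ a
    ... | yes refl = column l
    ... | no  c≢a  = ¬-not λ Rlc → aligned Rlc (column (punchIn l 0F)) (punchInᵢ≢i l 0F ∘ sym) c≢a

dictator : ∀ {t n} → Fin n → Fin t → VSet t n
dictator i b x = does (x i ≟ b)

IsDictator : ∀ {t n} → VSet t n → Set
IsDictator {t} {n} F = Σ (Fin n) λ i → Σ (Fin t) λ b → ∀ x → F x ≡ dictator i b x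

MeetsEveryClique : ∀ {t n} → VSet t n → Set
MeetsEveryClique {t} {n} F = ∀ (π : Fin n → Permutation′ t) → ∃ λ j → F (clique π j) ≡ true

IgnoresHead : ∀ {t m} → VSet t (suc m) → Vertex t m → Set
IgnoresHead F y = ∀ c c' → F (cons c y) ≡ F (cons c' y)

SelectsHead : ∀ {t m} → VSet t (suc m) → Fin t → Vertex t m → Set
SelectsHead F a y = ∀ c → F (cons c y) ≡ does (c ≟ a)

cons-adjacent : ∀ {t n} {c c' : Fin t} {x y : Vertex t n} → ¬ c ≡ c' → Adjacent x y →
                Adjacent (cons c x) (cons c' y)
cons-adjacent c≢c' x~y zero    = c≢c'
cons-adjacent c≢c' x~y (suc i) = x~y i

cons-congʳ : ∀ {t n} (c : Fin t) {x y : Vertex t n} → x ≗ y → cons c x ≗ cons c y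
cons-congʳ c x≗y zero    = refl
cons-congʳ c x≗y (suc i) = x≗y i

cons-head-tail : ∀ {t n} (x : Vertex t (suc n)) → x ≗ cons (x 0F) (tail x)
cons-head-tail x zero    = refl
cons-head-tail x (suc i) = refl

clique-∷ : ∀ {t n} (σ : Permutation′ t) (π : Fin n → Permutation′ t) j →
           clique (σ Vector.∷ π) j ≗ cons (σ ⟨$⟩ʳ j) (clique π j)
clique-∷ σ π j zero    = refl
clique-∷ σ π j (suc i) = refl

common-neighbour : ∀ {k n} (x y : Vertex (3 + k) n) → ∃ λ z → Adjacent x z × Adjacent z y
common-neighbour x y = (λ i → proj₁ (third (x i) (y i))) ,
                       (λ i eq → proj₁ (proj₂ (third (x i) (y i))) (sym eq)) ,
                       (λ i eq → proj₂ (proj₂ (third (x i) (y i))) eq)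
  where
  third : ∀ {k} (a b : Fin (3 + k)) → ∃ λ c → ¬ c ≡ a × ¬ c ≡ b
  third zero          zero          = 1F , (λ ()) , (λ ())
  third zero          (suc zero)    = 2F , (λ ()) , (λ ())
  third zero          (suc (suc _)) = 1F , (λ ()) , (λ ())
  third (suc zero)    zero          = 2F , (λ ()) , (λ ())
  third (suc (suc _)) zero          = 1F , (λ ()) , (λ ())
  third (suc _)       (suc _)       = 0F , (λ ()) , (λ ())

edge-closed⇒universal : ∀ {k n} {P : Vertex (3 + k) n → Set} → (∀ {x z} → Adjacent x z → P x → P z) →
                        ∀ {x} → P x → ∀ y → P y
edge-closed⇒universal along {x} Px y with z , x~z , z~y ← common-neighbour x y = along z~y (along x~z Px)

module HeadDichotomy {k m : ℕ} {F : VSet (3 + k) (suc m)} (F-cong : Congruent _≗_ _≡_ F)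
                     (indep : Independent F) (meets : MeetsEveryClique F) where
  private
    t : ℕ
    t = 3 + k

  clique-dichotomy : ∀ π → (∀ j → IgnoresHead F (clique π j)) ⊎ ∃ λ a → ∀ j → SelectsHead F a (clique π j)
  clique-dichotomy π with row-or-column-indicator (λ j c → F (cons c (clique π j))) aligned meets-perm
    where
    aligned : ∀ {j j' c c'} → F (cons c (clique π j)) ≡ true → F (cons c' (clique π j')) ≡ true →
              ¬ j ≡ j' → ¬ c ≡ c' → ⊥
    aligned Fjc Fj'c' j≢j' c≢c' = indep _ _ Fjc Fj'c' (cons-adjacent c≢c' (clique-adjacent π j≢j'))
    meets-perm : ∀ σ → ∃ λ j → F (cons (σ ⟨$⟩ʳ j) (clique π j)) ≡ true
    meets-perm σ with meets (σ Vector.∷ π)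
    ... | j , hit = j , trans (sym (F-cong (clique-∷ σ π j))) hit
  ... | inj₁ (_ , row)    = inj₁ λ j c c' → trans (row j c) (sym (row j c'))
  ... | inj₂ (a , column) = inj₂ (a , column)

  ignores-cong : ∀ {x y : Vertex t m} → x ≗ y → IgnoresHead F x → IgnoresHead F y
  ignores-cong x≗y ignores c c' =
    trans (F-cong (cons-congʳ c (sym ∘ x≗y))) (trans (ignores c c') (F-cong (cons-congʳ c' x≗y)))

  selects-cong : ∀ {a} {x y : Vertex t m} → x ≗ y → SelectsHead F a x → SelectsHead F a y
  selects-cong x≗y selects c = trans (F-cong (cons-congʳ c (sym ∘ x≗y))) (selects c)

  selects-unique : ∀ {a b} {x : Vertex t m} → SelectsHead F a x → SelectsHead F b x → a ≡ b
  selects-unique {a} {b} selects-a selects-b =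
    does-true (a ≟ b) (trans (sym (selects-b a)) (trans (selects-a a) (dec-true (a ≟ a) refl)))

  ¬ignores×selects : ∀ {a} {x : Vertex t m} → IgnoresHead F x → SelectsHead F a x → ⊥
  ¬ignores×selects {a} ignores selects = punchInᵢ≢i a 0F (does-true (c ≟ a)
    (trans (sym (selects c)) (trans (ignores c a) (trans (selects a) (dec-true (a ≟ a) refl)))))
    where c = punchIn a 0F

  edge-clique : ∀ {x z : Vertex t m} → Adjacent x z → ∃ λ π → x ≗ clique π 0F × z ≗ clique π 1F
  edge-clique x~z = (λ i → proj₁ (σ i)) , (λ i → sym (proj₁ (proj₂ (σ i)))) , (λ i → sym (proj₂ (proj₂ (σ i))))
    where σ = λ i → two-point-permutation {j = 0F} {1F} (λ ()) (x~z i)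

  ignores-along-edge : ∀ {x z : Vertex t m} → Adjacent x z → IgnoresHead F x → IgnoresHead F z
  ignores-along-edge x~z ignores with edge-clique x~z
  ... | π , x≗ , z≗ with clique-dichotomy π
  ...   | inj₁ all-ignore       = ignores-cong (sym ∘ z≗) (all-ignore 1F)
  ...   | inj₂ (_ , all-select) = ⊥-elim (¬ignores×selects ignores (selects-cong (sym ∘ x≗) (all-select 0F)))

  selects-along-edge : ∀ {a} {x z : Vertex t m} → Adjacent x z → SelectsHead F a x → SelectsHead F a z
  selects-along-edge x~z selects with edge-clique x~z
  ... | π , x≗ , z≗ with clique-dichotomy π
  ...   | inj₁ all-ignore       = ⊥-elim (¬ignores×selects (ignores-cong (sym ∘ x≗) (all-ignore 0F)) selects)
  ...   | inj₂ (b , all-select) rewrite selects-unique selects (selects-cong (sym ∘ x≗) (all-select 0F)) =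
    selects-cong (sym ∘ z≗) (all-select 1F)

  head-dichotomy : (∀ y → IgnoresHead F y) ⊎ ∃ λ a → ∀ y → SelectsHead F a y
  head-dichotomy with clique-dichotomy (λ _ → Perm.id)
  ... | inj₁ all-ignore       = inj₁ (edge-closed⇒universal ignores-along-edge (all-ignore 0F))
  ... | inj₂ (a , all-select) = inj₂ (a , edge-closed⇒universal selects-along-edge (all-select 0F))

dictator-of-meets-every-clique : ∀ {k} n {F : VSet (3 + k) n} → Congruent _≗_ _≡_ F → Independent F →
                                 MeetsEveryClique F → IsDictator F
-- In K_t^0 the empty word is adjacent to itself.
dictator-of-meets-every-clique zero F-cong indep meets with meets (λ ())
... | j , hit = ⊥-elim (indep (clique (λ ()) j) (clique (λ ()) j) hit hit (λ ()))
dictator-of-meets-every-clique (suc m) {F} F-cong indep meets with HeadDichotomy.head-dichotomy F-cong indep meets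
... | inj₂ (a , selects) = 0F , a , λ x → trans (F-cong (cons-head-tail x)) (selects (tail x) (x 0F))
... | inj₁ ignores with dictator-of-meets-every-clique m {F ∘ cons 0F} (F-cong ∘ cons-congʳ 0F) indep₀ meets₀
  where
  indep₀ : Independent (F ∘ cons 0F)
  indep₀ x y Fx Fy x~y = indep (cons 0F x) (cons 1F y) Fx (trans (ignores y 1F 0F) Fy) (cons-adjacent (λ ()) x~y)
  meets₀ : MeetsEveryClique (F ∘ cons 0F)
  meets₀ π with meets (Perm.id Vector.∷ π)
  ... | j , hit = j , trans (ignores (clique π j) 0F j) (trans (sym (F-cong (clique-∷ Perm.id π j))) hit)
... | i , b , F₀-dictator =
  suc i , b , λ x → trans (F-cong (cons-head-tail x)) (trans (ignores (tail x) (x 0F) 0F) (F₀-dictator (tail x)))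

independent-canon : ∀ {t n} {J : VSet t n} → Independent J → Independent (J ∘ canon)
independent-canon indep x y Jx Jy x~y =
  indep (canon x) (canon y) Jx Jy λ i eq → x~y i (trans (sym (canon-≗ x i)) (trans eq (canon-≗ y i)))

dictator-independent : ∀ {t n} (i : Fin n) (b : Fin t) → Independent (dictator i b)
dictator-independent i b x y x∈ y∈ x~y = x~y i (trans (does-true (x i ≟ b) x∈) (sym (does-true (y i ≟ b) y∈)))

module _ {k : ℕ} where
  private
    t : ℕ
    t = suc k

  card-dictator : ∀ {m} → card (dictator {t} {suc m} 0F 0F) ≡ t ^ m
  card-dictator {m} = begin
    card (dictator {t} {suc m} 0F 0F)                 ≡⟨ card-∑ᵥ (dictator {t} {suc m} 0F 0F) ⟩
    ∑ᵥ {t} m (λ _ → 1) + ∑[ _ < k ] ∑ᵥ {t} m (λ _ → 0)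
      ≡⟨ cong₂ _+_ (∑ᵥ-const m 1) (sum-cong-≗ {k} (λ _ → ∑ᵥ-zero m)) ⟩
    t ^ m * 1 + ∑[ _ < k ] 0                          ≡⟨ cong₂ _+_ (*-identityʳ (t ^ m)) (sum-replicate-zero k) ⟩
    t ^ m + 0                                         ≡⟨ +-identityʳ (t ^ m) ⟩
    t ^ m                                             ∎
    where open ≡-Reasoning

  maximum-independent-meets-every-clique : ∀ {m} {J : VSet t (suc m)} → MaximumIndependent J →
                                           MeetsEveryClique (J ∘ canon)
  maximum-independent-meets-every-clique {m} {J} (indep , maximum) π
    with any? (λ j → J (canon (clique π j)) Bool.≟ true)
  ... | yes hit = hit
  ... | no ¬hit = ⊥-elim (<⇒≱ (card-<-of-missed-clique indep π (λ j → ¬-not (¬hit ∘ (j ,_)))) (begin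
    t ^ suc m            ≡⟨ cong (t *_) (card-dictator {m}) ⟨
    t * card dictator₀   ≤⟨ *-monoʳ-≤ t (maximum dictator₀ (dictator-independent 0F 0F)) ⟩
    t * card J           ∎))
    where
    open ≤-Reasoning
    dictator₀ : VSet t (suc m)
    dictator₀ = dictator 0F 0F

maximum-independent⇒dictator : ∀ {k m} {J : VSet (3 + k) (suc m)} → MaximumIndependent J →
                               IsDictator (J ∘ canon)
maximum-independent⇒dictator {m = m} {J} maximum@(indep , _) =
  dictator-of-meets-every-clique (suc m) (cong J ∘ canon-cong) (independent-canon indep)
    (maximum-independent-meets-every-clique maximum)

-- The sets I n

module Family {a : ℕ} where
  private
    t : ℕ
    t = suc a

  isZero : Fin t → Bool
  isZero c = does (c ≟ 0F)

  allZero hasZero : ∀ {m} → Vertex t m → Bool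
  allZero {zero}  x = true
  allZero {suc m} x = isZero (x 0F) ∧ allZero (tail x)
  hasZero {zero}  x = false
  hasZero {suc m} x = isZero (x 0F) ∨ hasZero (tail x)

  I : ∀ n → VSet t n
  I zero    x = false
  I (suc m) x = if isZero (x 0F) then hasZero (tail x) else allZero (tail x)

  axis : ∀ {n} → Fin n → VSet t n
  axis zero    x = not (isZero (x 0F)) ∧ allZero (tail x)
  axis (suc j) x = isZero (x 0F) ∧ axis j (tail x)

  ∑ᵥ-allZero : ∀ m → ∑ᵥ m (𝟙 ∘ allZero) ≡ 1
  ∑ᵥ-allZero zero    = refl
  ∑ᵥ-allZero (suc m) = cong₂ _+_ (∑ᵥ-allZero m) (trans (sum-cong-≗ {a} λ _ → ∑ᵥ-zero m) (sum-replicate-zero a))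

  ∑ᵥ-noZero : ∀ m → ∑ᵥ m (𝟙 ∘ not ∘ hasZero) ≡ a ^ m
  ∑ᵥ-noZero zero    = refl
  ∑ᵥ-noZero (suc m) = cong₂ _+_ (∑ᵥ-zero m) (trans (sum-cong-≗ {a} λ _ → ∑ᵥ-noZero m) (∑-const a (a ^ m)))

  ∑ᵥ-hasZero : ∀ m → ∑ᵥ m (𝟙 ∘ hasZero) + a ^ m ≡ t ^ m
  ∑ᵥ-hasZero m = begin
    ∑ᵥ m (𝟙 ∘ hasZero) + a ^ m                           ≡⟨ cong (∑ᵥ m (𝟙 ∘ hasZero) +_) (∑ᵥ-noZero m) ⟨
    ∑ᵥ m (𝟙 ∘ hasZero) + ∑ᵥ m (𝟙 ∘ not ∘ hasZero)        ≡⟨ ∑ᵥ-distrib-+ m (𝟙 ∘ hasZero) (𝟙 ∘ not ∘ hasZero) ⟨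
    ∑ᵥ m (λ x → 𝟙 (hasZero x) + 𝟙 (not (hasZero x)))     ≡⟨ ∑ᵥ-cong m (𝟙-complement ∘ hasZero) ⟩
    ∑ᵥ m (λ _ → 1)                                       ≡⟨ ∑ᵥ-const m 1 ⟩
    t ^ m * 1                                            ≡⟨ *-identityʳ (t ^ m) ⟩
    t ^ m                                                ∎
    where open ≡-Reasoning

  card-I : ∀ m → card (I (suc m)) + a ^ m ≡ t ^ m + a
  card-I m = begin
    card (I (suc m)) + a ^ m                        ≡⟨ cong (_+ a ^ m) (card-∑ᵥ (I (suc m))) ⟩
    ∑ᵥ m (𝟙 ∘ hasZero) + ∑[ _ < a ] ∑ᵥ m (𝟙 ∘ allZero) + a ^ m
      ≡⟨ cong (λ u → ∑ᵥ m (𝟙 ∘ hasZero) + u + a ^ m) (trans (sum-cong-≗ {a} λ _ → ∑ᵥ-allZero m) (trans (∑-const a 1) (*-identityʳ a))) ⟩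
    ∑ᵥ m (𝟙 ∘ hasZero) + a + a ^ m                  ≡⟨ +-assoc (∑ᵥ m (𝟙 ∘ hasZero)) a (a ^ m) ⟩
    ∑ᵥ m (𝟙 ∘ hasZero) + (a + a ^ m)                ≡⟨ cong (∑ᵥ m (𝟙 ∘ hasZero) +_) (+-comm a (a ^ m)) ⟩
    ∑ᵥ m (𝟙 ∘ hasZero) + (a ^ m + a)                ≡⟨ +-assoc (∑ᵥ m (𝟙 ∘ hasZero)) (a ^ m) a ⟨
    ∑ᵥ m (𝟙 ∘ hasZero) + a ^ m + a                  ≡⟨ cong (_+ a) (∑ᵥ-hasZero m) ⟩
    t ^ m + a                                       ∎
    where open ≡-Reasoning

  ∑ᵥ-axis : ∀ {n} (j : Fin n) → ∑ᵥ n (𝟙 ∘ axis j) ≡ a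
  ∑ᵥ-axis {suc m} zero    = trans (cong₂ _+_ (∑ᵥ-zero m) (sum-cong-≗ {a} λ _ → ∑ᵥ-allZero m)) (trans (∑-const a 1) (*-identityʳ a))
  ∑ᵥ-axis {suc m} (suc j) = trans (cong₂ _+_ (∑ᵥ-axis j) (trans (sum-cong-≗ {a} λ _ → ∑ᵥ-zero m) (sum-replicate-zero a))) (+-identityʳ a)

  allZero-sound : ∀ {m} {x : Vertex t m} → allZero x ≡ true → ∀ i → x i ≡ 0F
  allZero-sound {x = x} all0 zero    = does-true (x 0F ≟ 0F) (∧-conicalˡ _ _ all0)
  allZero-sound {x = x} all0 (suc i) = allZero-sound (∧-conicalʳ (isZero (x 0F)) _ all0) i

  hasZero-sound : ∀ {m} {x : Vertex t m} → hasZero x ≡ true → ∃ λ i → x i ≡ 0F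
  hasZero-sound {suc m} {x} has0 with x 0F ≟ 0F
  ... | yes x₀≡0 = 0F , x₀≡0
  ... | no  _    with i , xᵢ≡0 ← hasZero-sound has0 = suc i , xᵢ≡0

  hasZero-complete : ∀ {m} {x : Vertex t m} i → x i ≡ 0F → hasZero x ≡ true
  hasZero-complete {x = x} zero    x₀≡0 = cong (_∨ hasZero (tail x)) (dec-true (x 0F ≟ 0F) x₀≡0)
  hasZero-complete {x = x} (suc i) xᵢ≡0 = trans (cong (isZero (x 0F) ∨_) (hasZero-complete i xᵢ≡0)) (∨-zeroʳ _)

  axis-nonzero : ∀ {n} {j : Fin n} {x : Vertex t n} → axis j x ≡ true → ¬ x j ≡ 0F
  axis-nonzero {j = zero}  {x} ax x₀≡0
    with () ← trans (sym (cong (λ b → not b ∧ allZero (tail x)) (dec-true (x 0F ≟ 0F) x₀≡0))) ax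
  axis-nonzero {j = suc j} {x} ax = axis-nonzero {x = tail x} (∧-conicalʳ (isZero (x 0F)) _ ax)

  axis-zero-elsewhere : ∀ {n} {j i : Fin n} {x : Vertex t n} → axis j x ≡ true → ¬ i ≡ j → x i ≡ 0F
  axis-zero-elsewhere {j = zero}  {zero}      ax i≢j = ⊥-elim (i≢j refl)
  axis-zero-elsewhere {j = zero}  {suc i} {x} ax _   = allZero-sound (∧-conicalʳ (not (isZero (x 0F))) _ ax) i
  axis-zero-elsewhere {j = suc j} {zero}  {x} ax _   = does-true (x 0F ≟ 0F) (∧-conicalˡ _ _ ax)
  axis-zero-elsewhere {j = suc j} {suc i} {x} ax i≢j = axis-zero-elsewhere (∧-conicalʳ (isZero (x 0F)) _ ax) (i≢j ∘ cong suc)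

  I-independent : ∀ m → Independent (I (2 + m))
  I-independent m x y Ix Iy x~y with x 0F ≟ 0F | y 0F ≟ 0F
  ... | yes x₀≡0 | yes y₀≡0 = x~y 0F (trans x₀≡0 (sym y₀≡0))
  ... | yes _    | no  _    with i , xᵢ≡0 ← hasZero-sound {x = tail x} Ix = x~y (suc i) (trans xᵢ≡0 (sym (allZero-sound {x = tail y} Iy i)))
  ... | no  _    | yes _    with i , yᵢ≡0 ← hasZero-sound {x = tail y} Iy = x~y (suc i) (trans (allZero-sound {x = tail x} Ix i) (sym yᵢ≡0))
  ... | no  _    | no  _    = x~y 1F (trans (allZero-sound {x = tail x} Ix 0F) (sym (allZero-sound {x = tail y} Iy 0F)))

  axis⊆I : ∀ {m} (j : Fin (3 + m)) (x : Vertex t (3 + m)) → axis j x ≡ true → I (3 + m) x ≡ true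
  axis⊆I zero    x ax with x 0F ≟ 0F
  ... | no _ = ax
  axis⊆I zero    x () | yes _
  axis⊆I (suc j) x ax with x 0F ≟ 0F
  ... | yes _ = hasZero-complete {x = tail x} (punchIn j 0F) (axis-zero-elsewhere ax (punchInᵢ≢i j 0F))
  axis⊆I (suc j) x () | no _

  a≤card-I∖dictator : ∀ {m} {J : VSet t (3 + m)} → IsDictator (J ∘ canon) → a ≤ card (I (3 + m) ∖ J)
  a≤card-I∖dictator {m} {J} (i , b , J-dictator) = begin
    a                                  ≡⟨ ∑ᵥ-axis j ⟨
    ∑ᵥ n (𝟙 ∘ axis j)                  ≡⟨ ∑ᵥ-canon n (𝟙 ∘ axis j) ⟨
    ∑ᵥ n (𝟙 ∘ axis j ∘ canon)          ≤⟨ ∑ᵥ-mono-≤ n (λ x → 𝟙-mono (axis⊆I∖J x)) ⟩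
    ∑ᵥ n (𝟙 ∘ (I n ∖ J) ∘ canon)       ≡⟨ ∑ᵥ-canon n (𝟙 ∘ (I n ∖ J)) ⟩
    ∑ᵥ n (𝟙 ∘ (I n ∖ J))               ≡⟨ card-∑ᵥ (I n ∖ J) ⟨
    card (I n ∖ J)                     ∎
    where
    open ≤-Reasoning
    n = 3 + m

    avoiding-axis : ∃ λ j → ∀ {y} → axis j y ≡ true → ¬ y i ≡ b
    avoiding-axis with b ≟ 0F
    ... | yes refl = i , λ {y} → axis-nonzero {x = y}
    ... | no  b≢0  = punchIn i 0F , λ ax yᵢ≡b → b≢0 (trans (sym yᵢ≡b) (axis-zero-elsewhere ax (punchInᵢ≢i i 0F ∘ sym)))

    j = proj₁ avoiding-axis

    axis⊆I∖J : ∀ x → axis j (canon x) ≡ true → (I n ∖ J) (canon x) ≡ true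
    axis⊆I∖J x ax = cong₂ (λ u v → u ∧ not v) (axis⊆I j (canon x) ax)
      (trans (J-dictator x) (dec-false (x i ≟ b) (proj₂ avoiding-axis ax ∘ trans (canon-≗ x i))))

-- Arithmetic of the exponent

^-distribʳ-* : ∀ x y r → (x * y) ^ r ≡ x ^ r * y ^ r
^-distribʳ-* x y zero    = refl
^-distribʳ-* x y (suc r) = trans (cong (x * y *_) (^-distribʳ-* x y r)) (interchange x y (x ^ r) (y ^ r))
  where
  interchange : ∀ x y p q → x * y * (p * q) ≡ x * p * (y * q)
  interchange = solve-∀

^-comm : ∀ x p q → (x ^ p) ^ q ≡ (x ^ q) ^ p
^-comm x p q = trans (^-*-assoc x p q) (trans (cong (x ^_) (*-comm p q)) (sym (^-*-assoc x q p)))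

-- Bernoulli's inequality (1 + 1/x)^r ≥ 1 + r/x, with denominators cleared.
bernoulli : ∀ x r → x ^ r * (x + r) ≤ suc x ^ r * x
bernoulli x zero    = ≤-reflexive (trans (*-identityˡ (x + 0)) (trans (+-identityʳ x) (sym (*-identityˡ x))))
bernoulli x (suc r) = begin
  x * x ^ r * (x + suc r)                ≤⟨ m≤m+n _ (x ^ r * r) ⟩
  x * x ^ r * (x + suc r) + x ^ r * r    ≡⟨ regroup x (x ^ r) r ⟩
  suc x * (x ^ r * (x + r))              ≤⟨ *-monoʳ-≤ (suc x) (bernoulli x r) ⟩
  suc x * (suc x ^ r * x)                ≡⟨ *-assoc (suc x) (suc x ^ r) x ⟨
  suc x ^ suc r * x                      ∎
  where
  open ≤-Reasoning
  regroup : ∀ x p r → x * p * (x + suc r) + p * r ≡ suc x * (p * (x + r))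
  regroup = solve-∀

bernoulli-gap : ∀ K X → 0 < X → K * X ^ (K * X) < suc X ^ (K * X)
bernoulli-gap K X@(suc _) _ = *-cancelʳ-< X _ _ (begin-strict
  K * X ^ r * X               <⟨ m<n+m (K * X ^ r * X) (*-mono-< (m^n>0 X r) 0<1+n) ⟩
  X ^ r * X + K * X ^ r * X   ≡⟨ distribute (X ^ r) K X ⟨
  X ^ r * (X + r)             ≤⟨ bernoulli X r ⟩
  suc X ^ r * X               ∎)
  where
  open ≤-Reasoning
  r : ℕ
  r = K * X
  distribute : ∀ p K X → p * (X + K * X) ≡ p * X + K * p * X
  distribute = solve-∀

k*aᵐ<[1+a]ᵐ : ∀ {k a m} → 0 < a → 0 < k → k * suc a ≤ m → k * a ^ m < suc a ^ m
k*aᵐ<[1+a]ᵐ {k@(suc _)} {a@(suc _)} {m} _ _ k[1+a]≤m = *-cancelʳ-< a _ _ (begin-strict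
  k * a ^ m * a     ≡⟨ rearrange k (a ^ m) a ⟩
  a ^ m * (k * a)   <⟨ *-monoʳ-< (a ^ m) {{m^n≢0 a m}} ka<a+m ⟩
  a ^ m * (a + m)   ≤⟨ bernoulli a m ⟩
  suc a ^ m * a     ∎)
  where
  open ≤-Reasoning
  rearrange : ∀ k p a → k * p * a ≡ p * (k * a)
  rearrange = solve-∀
  ka<a+m : k * a < a + m
  ka<a+m = <-≤-trans (*-monoʳ-< k (n<1+n a)) (≤-trans k[1+a]≤m (m≤n+m m a))

first-crossing : ∀ {P : ℕ → Set} → Decidable P → ¬ P 0 → ∀ N → P N → ∃ λ s → ¬ P s × P (suc s)
first-crossing P? ¬P0 zero    P0 = ⊥-elim (¬P0 P0)
first-crossing P? ¬P0 (suc N) PN with P? N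
... | yes PN-1 = first-crossing P? ¬P0 N PN-1
... | no ¬PN-1 = N , ¬PN-1 , PN

module _ {a X m r s : ℕ} .{{_ : NonZero a}} (a[1+X]≡aᵐ : a * suc X ≡ a ^ m)
         (below-crossing : suc a ^ s * a ^ r ≤ suc a ^ r) (gap : suc a ^ m * X ^ r < suc X ^ r) where
  private
    t T : ℕ
    t = suc a
    T = t ^ m

  crossing-bound : a ^ r * X ^ r * T ^ suc s < T ^ r
  crossing-bound = begin-strict
    a ^ r * X ^ r * (T * T ^ s)        ≡⟨ rearrange (a ^ r) (X ^ r) T (T ^ s) ⟩
    T * X ^ r * (a ^ r * T ^ s)        <⟨ *-monoˡ-< (a ^ r * T ^ s) gap ⟩
    suc X ^ r * (a ^ r * T ^ s)        ≡⟨ rearrange′ (suc X ^ r) (a ^ r) (T ^ s) ⟩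
    a ^ r * suc X ^ r * T ^ s          ≡⟨ cong (_* T ^ s) (^-distribʳ-* a (suc X) r) ⟨
    (a * suc X) ^ r * T ^ s            ≡⟨ cong (λ u → u ^ r * T ^ s) a[1+X]≡aᵐ ⟩
    (a ^ m) ^ r * (t ^ m) ^ s          ≡⟨ cong₂ _*_ (^-comm a m r) (^-comm t m s) ⟩
    (a ^ r) ^ m * (t ^ s) ^ m          ≡⟨ *-comm ((a ^ r) ^ m) ((t ^ s) ^ m) ⟩
    (t ^ s) ^ m * (a ^ r) ^ m          ≡⟨ ^-distribʳ-* (t ^ s) (a ^ r) m ⟨
    (t ^ s * a ^ r) ^ m                ≤⟨ ^-monoˡ-≤ m below-crossing ⟩
    (t ^ r) ^ m                        ≡⟨ ^-comm t r m ⟩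
    T ^ r                              ∎
    where
    open ≤-Reasoning
    instance
      _ = m^n≢0 a r
      _ = m^n≢0 t m
      _ = m^n≢0 T s
      _ = m*n≢0 (a ^ r) (T ^ s)
    rearrange : ∀ A B C D → A * B * (C * D) ≡ C * B * (A * D)
    rearrange = solve-∀
    rearrange′ : ∀ A B C → A * (B * C) ≡ B * A * C
    rearrange′ = solve-∀

  crossing-bound-cleared : ∀ {d} → a ≤ d →
    (t * (a * X)) ^ r * (t * T * a) ^ suc s < (d * t) ^ suc s * (t * T) ^ r
  crossing-bound-cleared {d} a≤d = begin-strict
    (t * (a * X)) ^ r * (t * T * a) ^ S
      ≡⟨ cong₂ _*_ (trans (^-distribʳ-* t (a * X) r) (cong (t ^ r *_) (^-distribʳ-* a X r)))
                   (trans (^-distribʳ-* (t * T) a S) (cong (_* a ^ S) (^-distribʳ-* t T S))) ⟩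
    t ^ r * (a ^ r * X ^ r) * (t ^ S * T ^ S * a ^ S)  ≡⟨ rearrange (t ^ r) (a ^ r) (X ^ r) (t ^ S) (T ^ S) (a ^ S) ⟩
    a ^ r * X ^ r * T ^ S * W                          <⟨ *-monoˡ-< W crossing-bound ⟩
    T ^ r * W                                          ≡⟨ rearrange′ (T ^ r) (t ^ r) (t ^ S) (a ^ S) ⟩
    a ^ S * t ^ S * (t ^ r * T ^ r)                    ≡⟨ cong₂ _*_ (^-distribʳ-* a t S) (^-distribʳ-* t T r) ⟨
    (a * t) ^ S * (t * T) ^ r                          ≤⟨ *-monoˡ-≤ ((t * T) ^ r) (^-monoˡ-≤ S (*-monoˡ-≤ t a≤d)) ⟩
    (d * t) ^ S * (t * T) ^ r                          ∎
    where
    open ≤-Reasoning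
    S W : ℕ
    S = suc s
    W = t ^ r * t ^ S * a ^ S
    instance
      _ = m^n≢0 t r
      _ = m^n≢0 t S
      _ = m^n≢0 a S
      _ = m*n≢0 (t ^ r) (t ^ S)
      _ = m*n≢0 (t ^ r * t ^ S) (a ^ S)
    rearrange : ∀ A B C D E F → A * (B * C) * (D * E * F) ≡ B * C * E * (A * D * F)
    rearrange = solve-∀
    rearrange′ : ∀ A B C D → A * (B * C * D) ≡ D * C * (B * A)
    rearrange′ = solve-∀

module Construction (k : ℕ) where
  private
    t a : ℕ
    t = 3 + k
    a = 2 + k
  open Family {a} public using (I; I-independent)
  open Family {a} using (card-I; a≤card-I∖dictator)

  module _ (m : ℕ) where
    private
      n T : ℕ
      n = 3 + m
      T = t ^ (2 + m)

    X : ℕ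
    X = pred (a ^ suc m)

    a[1+X]≡aᵐ : a * suc X ≡ a ^ (2 + m)
    a[1+X]≡aᵐ = cong (a *_) (suc-pred (a ^ suc m) {{m^n≢0 a (suc m)}})

    0<X : 0 < X
    0<X = pred-mono-≤ (≤-trans (s≤s (s≤s z≤n)) (m≤m*n a (a ^ m) {{m^n≢0 a m}}))

    card-I+aX : card (I n) + a * X ≡ T
    card-I+aX = +-cancelʳ-≡ a _ _ (begin
      card (I n) + a * X + a    ≡⟨ +-assoc (card (I n)) (a * X) a ⟩
      card (I n) + (a * X + a)  ≡⟨ cong (card (I n) +_) (trans (+-comm (a * X) a) (sym (*-suc a X))) ⟩
      card (I n) + a * suc X    ≡⟨ cong (card (I n) +_) a[1+X]≡aᵐ ⟩
      card (I n) + a ^ (2 + m)  ≡⟨ card-I (2 + m) ⟩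
      T + a                     ∎)
      where open ≡-Reasoning

    tⁿ-split : t ^ n ≡ t * card (I n) + t * (a * X)
    tⁿ-split = trans (cong (t *_) (sym card-I+aX)) (*-distribˡ-+ t (card (I n)) (a * X))

    ε-numerator : t ^ n ∸ t * card (I n) ≡ t * (a * X)
    ε-numerator = trans (cong (_∸ t * card (I n)) tⁿ-split) (m+n∸m≡n (t * card (I n)) (t * (a * X)))

    ε-positive : EpsPos (I n)
    ε-positive = subst (t * card (I n) <_) (sym tⁿ-split)
      (m<m+n (t * card (I n)) (*-mono-≤ {1} {t} z<s (*-mono-≤ {1} {a} z<s 0<X)))

    ε-below : ∀ {κ} → 0 < κ → κ * t ≤ 2 + m → EpsBelow (I n) κ
    ε-below {κ} 0<κ κt≤2+m = begin-strict
      κ * (t ^ n ∸ t * card (I n))   ≡⟨ cong (κ *_) ε-numerator ⟩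
      κ * (t * (a * X))              ≤⟨ *-monoʳ-≤ κ (*-monoʳ-≤ t (≤-trans (*-monoʳ-≤ a (n≤1+n X)) (≤-reflexive a[1+X]≡aᵐ))) ⟩
      κ * (t * a ^ (2 + m))          ≡⟨ x*[y*z]≡y*[x*z] κ t (a ^ (2 + m)) ⟩
      t * (κ * a ^ (2 + m))          <⟨ *-monoʳ-< t (k*aᵐ<[1+a]ᵐ z<s 0<κ κt≤2+m) ⟩
      t * T                          ∎
      where
      open ≤-Reasoning
      x*[y*z]≡y*[x*z] : ∀ x y z → x * (y * z) ≡ y * (x * z)
      x*[y*z]≡y*[x*z] = solve-∀

    r : ℕ
    r = T * X

    0<r : 0 < r
    0<r = *-mono-≤ (m^n>0 t (2 + m)) 0<X

    ¬below₀ : ¬ RatBelowEta t r 0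
    ¬below₀ tʳ<aʳ = <⇒≱ tʳ<aʳ (≤-trans (≤-reflexive (+-identityʳ (a ^ r))) (^-monoˡ-≤ r (n≤1+n a)))

    belowᵣ : RatBelowEta t r r
    belowᵣ = m<m*n (t ^ r) (a ^ r) {{m^n≢0 t r}} (^-monoʳ-< a (s≤s (s≤s z≤n)) 0<r)

    μ-diff-exceeds : ∀ {J} → MaximumIndependent J → MuDiffExceeds (I n) J
    μ-diff-exceeds {J} maximum
      with s , ¬below , below ← first-crossing (λ s → t ^ r <? t ^ s * a ^ r) ¬below₀ r belowᵣ
      = r , suc s , z<s , below ,
        subst (λ E → E ^ r * (t ^ n * a) ^ suc s < (card (I n ∖ J) * t) ^ suc s * (t ^ n) ^ r) (sym ε-numerator)
          (crossing-bound-cleared {a} {X} {2 + m} {r} {s} a[1+X]≡aᵐ (≮⇒≥ ¬below) (bernoulli-gap T X 0<X)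
            (a≤card-I∖dictator (maximum-independent⇒dictator maximum)))

at-least-3 : ∀ (P : ℕ → Set) → (∀ m → P (3 + m)) → ∀ n → 3 ≤ n → P n
at-least-3 P P₃₊ n 3≤n with m , refl ← m≤n⇒∃[o]m+o≡n 3≤n = P₃₊ m

lemmaC1 : (t : ℕ) → 3 ≤ t →
    Σ ((n : ℕ) → VSet t n) λ I →
      ((n : ℕ) → 3 ≤ n → Independent (I n))
      × ((n : ℕ) → 3 ≤ n → EpsPos (I n))
      × ((k : ℕ) → 0 < k → Σ ℕ λ m → (n : ℕ) → 3 ≤ n → m ≤ n → EpsBelow (I n) k)
      × ((n : ℕ) → 3 ≤ n → (J : VSet t n) → MaximumIndependent J → MuDiffExceeds (I n) J)
lemmaC1 t 3≤t with k , refl ← m≤n⇒∃[o]m+o≡n 3≤t =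
  I ,
  at-least-3 _ (λ m → I-independent (suc m)) ,
  at-least-3 _ ε-positive ,
  (λ κ 0<κ → suc (κ * t) , at-least-3 (λ n → suc (κ * t) ≤ n → EpsBelow (I n) κ) (λ m → ε-below m 0<κ ∘ ≤-pred)) ,
  at-least-3 _ (λ m J → μ-diff-exceeds m)
  where open Construction k
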